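{- Let $n$ be a positive integer and $b>1$ an integer. Then $2^n$ has a 3-digit palindromic representation in base $b$ (that is, $2^n=c+db+cb^2$ for integers $1\le c\le b-1$, $0\le d\le b-1$) if and only if $b^2+1\le 2^n\le b^3-1$, the integer $c:=2^n \bmod b$ is nonzero, and \[\frac{1}{b}\left\lfloor\frac{2^n}{b}\right\rfloor-\frac{b-1}{b}\;\le\; c\;\le\;\frac{1}{b}\left\lfloor\frac{2^n}{b}\right\rfloor.\]
   Context: For an integer $b>1$, every positive integer $N$ can be written uniquely as $N=\sum_{i=0}^m c_i b^i$ with integers $0\le c_i<b$ and $c_m>0$; this is written $N=(c_m,\ldots,c_0)_b$ and has $m+1$ digits. It is palindromic if $c_j=c_{m-j}$ for all $j$. Here $2^n \bmod b$ denotes the least nonnegative residue of $2^n$ modulo $b$. -}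

module Defs where

open import Data.Nat using (ℕ; _+_; _*_; _∸_; _^_; _≤_; _<_; NonZero)
open import Data.Product using (Σ; _×_)

ThreeDigitPalindrome : ℕ → ℕ → Set
ThreeDigitPalindrome b N =
  Σ ℕ λ c → Σ ℕ λ d →
    (1 ≤ c) × (c ≤ b ∸ 1) × (d ≤ b ∸ 1) × (N ≡ c + d * b + c * (b ^ 2))
  where open import Relation.Binary.PropositionalEquality using (_≡_)

-- Reading N = c + d b + c b² in Horner form N = c + (d + c b) b shows that a
-- palindrome (c, d, c) is pinned down by the division of N by b: the last digit
-- is c = N mod b and the quotient is ⌊N/b⌋ = d + c b, so the middle digit
-- d = ⌊N/b⌋ − b c lies in [0, b) exactly when b c ≤ ⌊N/b⌋ ≤ b c + (b − 1).
-- The range b² + 1 ≤ N ≤ b³ − 1 is then automatic. Nothing about 2ⁿ or b > 1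
-- is used: the criterion holds for every N and every b > 0.
module Submission where

open import Defs
open import Data.Nat using (ℕ; suc; _+_; _*_; _∸_; _^_; _≤_; _<_; NonZero; s≤s)
open import Data.Nat.DivMod
  using (_/_; _%_; m≡m%n+[m/n]*n; m%n<n; [m+kn]%n≡m%n; m<n⇒m%n≡m;
         m<n⇒m/n≡0; m*n/n≡m; +-distrib-/-∣ʳ)
open import Data.Nat.Divisibility using (n∣m*n)
open import Data.Nat.Properties
open import Data.Nat.Tactic.RingSolver using (solve-∀)
open import Data.Product using (_×_; _,_)
open import Function.Bundles using (_⇔_; mk⇔)
open import Relation.Binary.PropositionalEquality

<⇒≤∸1 : ∀ {m n} → m < n → m ≤ n ∸ 1
<⇒≤∸1 (s≤s m≤n) = m≤n

≤∸1⇒< : ∀ {m n} .{{_ : NonZero n}} → m ≤ n ∸ 1 → m < n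
≤∸1⇒< {n = suc _} = s≤s

[m+kn]%n≡m : ∀ {m n} k .{{_ : NonZero n}} → m < n → (m + k * n) % n ≡ m
[m+kn]%n≡m {m} {n} k m<n = trans ([m+kn]%n≡m%n m k n) (m<n⇒m%n≡m m<n)

[m+kn]/n≡k : ∀ {m n} k .{{_ : NonZero n}} → m < n → (m + k * n) / n ≡ k
[m+kn]/n≡k {m} {n} k m<n = begin
  (m + k * n) / n     ≡⟨ +-distrib-/-∣ʳ m (n∣m*n k) ⟩
  m / n + k * n / n   ≡⟨ cong₂ _+_ (m<n⇒m/n≡0 m<n) (m*n/n≡m k n) ⟩
  k                   ∎
  where open ≡-Reasoning

palindrome-horner : ∀ b c d → c + d * b + c * b ^ 2 ≡ c + (d + c * b) * b
palindrome-horner = horner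
  where
  -- b ^ 2 unfolds to b * (b * 1); the solver cannot reflect _^_ itself.
  horner : ∀ b c d → c + d * b + c * (b * (b * 1)) ≡ c + (d + c * b) * b
  horner = solve-∀

palindrome-lower : ∀ {b c} d → 1 ≤ c → b ^ 2 + 1 ≤ c + d * b + c * b ^ 2
palindrome-lower {b} {c} d 1≤c = begin
  b ^ 2 + 1           ≡⟨ +-comm (b ^ 2) 1 ⟩
  1 + b ^ 2           ≡⟨ cong (1 +_) (*-identityˡ (b ^ 2)) ⟨
  1 + 1 * b ^ 2       ≤⟨ +-mono-≤ 1≤c (*-monoˡ-≤ (b ^ 2) 1≤c) ⟩
  c + c * b ^ 2       ≤⟨ +-monoˡ-≤ (c * b ^ 2) (m≤m+n c (d * b)) ⟩
  c + d * b + c * b ^ 2 ∎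
  where open ≤-Reasoning

palindrome-upper : ∀ {b c d} → c < b → d < b → c + d * b + c * b ^ 2 < b ^ 3
palindrome-upper {b} {c} {d} c<b d<b = begin
  suc c + d * b + c * b ^ 2 ≤⟨ +-monoˡ-≤ (c * b ^ 2) (+-monoˡ-≤ (d * b) c<b) ⟩
  suc d * b + c * b ^ 2     ≤⟨ +-monoˡ-≤ (c * b ^ 2) (*-monoˡ-≤ b d<b) ⟩
  b * b + c * b ^ 2         ≡⟨ cong (λ x → b * x + c * b ^ 2) (*-identityʳ b) ⟨
  suc c * b ^ 2             ≤⟨ *-monoˡ-≤ (b ^ 2) c<b ⟩
  b ^ 3                     ∎
  where open ≤-Reasoning

PalindromeCriterion : (b N : ℕ) .{{_ : NonZero b}} → Set
PalindromeCriterion b N =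
  (b ^ 2 + 1 ≤ N) × (N ≤ b ^ 3 ∸ 1) × (1 ≤ N % b)
    × (N / b ≤ b * (N % b) + (b ∸ 1)) × (b * (N % b) ≤ N / b)

module _ {b : ℕ} .{{_ : NonZero b}} where

  palindrome%b : ∀ {c} d → c < b → (c + d * b + c * b ^ 2) % b ≡ c
  palindrome%b {c} d c<b =
    trans (cong (_% b) (palindrome-horner b c d)) ([m+kn]%n≡m (d + c * b) c<b)

  palindrome/b : ∀ {c} d → c < b → (c + d * b + c * b ^ 2) / b ≡ d + c * b
  palindrome/b {c} d c<b =
    trans (cong (_/ b) (palindrome-horner b c d)) ([m+kn]/n≡k (d + c * b) c<b)

  palindrome⇒criterion : ∀ {N} → ThreeDigitPalindrome b N → PalindromeCriterion b N
  palindrome⇒criterion (c , d , 1≤c , c≤b∸1 , d≤b∸1 , refl)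
    rewrite palindrome%b d (≤∸1⇒< c≤b∸1) | palindrome/b d (≤∸1⇒< c≤b∸1) =
      palindrome-lower d 1≤c ,
      <⇒≤∸1 (palindrome-upper (≤∸1⇒< c≤b∸1) (≤∸1⇒< d≤b∸1)) ,
      1≤c ,
      ≤-trans (≤-reflexive (+-comm d (c * b))) (+-mono-≤ (≤-reflexive (*-comm c b)) d≤b∸1) ,
      ≤-trans (≤-reflexive (*-comm b c)) (m≤n+m (c * b) d)

  criterion⇒palindrome : ∀ {N} → PalindromeCriterion b N → ThreeDigitPalindrome b N
  criterion⇒palindrome {N} (_ , _ , 1≤r , q≤br+b∸1 , br≤q) =
    r , q ∸ b * r , 1≤r , <⇒≤∸1 (m%n<n N b) , m≤n+o⇒m∸n≤o q (b * r) q≤br+b∸1 , N≡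
    where
    r = N % b
    q = N / b
    open ≡-Reasoning
    N≡ : N ≡ r + (q ∸ b * r) * b + r * b ^ 2
    N≡ = begin
      N                                 ≡⟨ m≡m%n+[m/n]*n N b ⟩
      r + q * b                         ≡⟨ cong (λ x → r + x * b) (m∸n+n≡m br≤q) ⟨
      r + (q ∸ b * r + b * r) * b       ≡⟨ cong (λ x → r + (q ∸ b * r + x) * b) (*-comm b r) ⟩
      r + (q ∸ b * r + r * b) * b       ≡⟨ palindrome-horner b r (q ∸ b * r) ⟨
      r + (q ∸ b * r) * b + r * b ^ 2   ∎

  palindrome⇔criterion : ∀ {N} → ThreeDigitPalindrome b N ⇔ PalindromeCriterion b N
  palindrome⇔criterion = mk⇔ palindrome⇒criterion criterion⇒palindrome

theorem2p1 : (n b : ℕ) → 1 ≤ n → (b>1 : 1 < b) → .{{_ : NonZero b}} →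
    ThreeDigitPalindrome b (2 ^ n) ⇔
      ((b ^ 2 + 1 ≤ 2 ^ n) × (2 ^ n ≤ b ^ 3 ∸ 1) × (1 ≤ 2 ^ n % b)
        × ((2 ^ n / b) ≤ b * (2 ^ n % b) + (b ∸ 1))
        × (b * (2 ^ n % b) ≤ (2 ^ n / b)))
theorem2p1 n b _ _ = palindrome⇔criterion
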